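{- Let $p_j\geq 5$ be the $j$-th prime (with $p_1=2$) and $L(p_j)=\prod_{5\le p\le p_j}p$. (i) The number of remnants of the supergroup $\mathcal S_{p_j}$ per period $L(p_j)$ (that is, $L(p_j)$ times the natural density of the set of odd positive integers not in $\mathcal S_{p_j}$) is $$R(p_j)=\frac12L(p_j)-S(p_j)=\frac12\prod_{5\leq p\leq p_j}(p-2)=\frac12G(p_{j+1}),$$ where $S(p_j)=\frac12L(p_j)\big(1-\prod_{5\le p\le p_j}\frac{p-2}{p}\big)$ and $G(p_{j+1})=\prod_{5\le p<p_{j+1}}(p-2)$. (ii) The fraction of remnants $x(p_j)=R(p_j)/L(p_j)=\frac12\prod_{5\leq p\leq p_j}\frac{p-2}{p}$ decreases monotonically as $p_j\to\infty$. (All products over primes.)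
   Context: For real $x$, $N(x)$ is the integer nearest to $x$. For a prime $q\geq 5$, the non-ranks of $q$ are the integers $(2n+1)q+4N(q/6)$ with $n\geq 0$ and $(2n+1)q-4N(q/6)$ with $n\geq 1$. The supergroup $\mathcal S_{p_j}$ is the set of integers that are non-ranks of some prime $p$ with $5\le p\le p_j$. Remnants of $\mathcal S_{p_j}$ are (odd) integers not belonging to $\mathcal S_{p_j}$. -}

module Defs where

open import Data.Nat using (ℕ; zero; suc; _+_; _*_; _∸_; _≤_; _<_; _≤?_; _/_)
open import Data.Nat.Primality using (Prime; prime?)
open import Data.Bool using (Bool; true; false; if_then_else_; _∧_)
open import Relation.Nullary.Decidable using (⌊_⌋)
open import Relation.Nullary using (¬_)
open import Data.Product using (Σ; _×_; ∃)
open import Data.Sum using (_⊎_)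
open import Relation.Binary.PropositionalEquality using (_≡_)
open import Data.Integer using (+_)
open import Data.Rational as ℚ using (ℚ; ½)

-- nearest integer to a/b (b > 0): floor((2a+b)/(2b)); ties rounded up
-- (ties never occur for q/6 with q ≥ 5 prime).
nearest : ℕ → (b : ℕ) → ℕ
nearest a zero = 0
nearest a (suc b) = (2 * a + suc b) / (2 * suc b)

off : ℕ → ℕ
off q = 4 * nearest q 6

-- m is a non-rank of q:  m = (2n+1)q + 4N(q/6) with n ≥ 0,
-- or m = (2n+1)q − 4N(q/6) with n ≥ 1 (written additively in ℕ).
NonRank : ℕ → ℕ → Set
NonRank q m =
  Σ ℕ (λ n → (m ≡ (2 * n + 1) * q + off q)
           ⊎ ((1 ≤ n) × (m + off q ≡ (2 * n + 1) * q)))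

InS : ℕ → ℕ → Set
InS P m = Σ ℕ (λ q → Prime q × (5 ≤ q) × (q ≤ P) × NonRank q m)

Odd : ℕ → Set
Odd m = Σ ℕ (λ k → m ≡ 2 * k + 1)

Remnant : ℕ → ℕ → Set
Remnant P m = Odd m × ¬ InS P m

-- CountIs A N k : exactly k integers m with 1 ≤ m ≤ N satisfy A
data CountIs (A : ℕ → Set) : ℕ → ℕ → Set where
  c-zero : CountIs A 0 0
  c-yes  : ∀ {N k} → A (suc N) → CountIs A N k → CountIs A (suc N) (suc k)
  c-no   : ∀ {N k} → ¬ A (suc N) → CountIs A N k → CountIs A (suc N) k

isP5 : ℕ → Bool
isP5 p = ⌊ 5 ≤? p ⌋ ∧ ⌊ prime? p ⌋

prodP : (ℕ → ℕ) → ℕ → ℕ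
prodP f zero = 1
prodP f (suc n) = if isP5 (suc n) then f (suc n) * prodP f n else prodP f n

ratioProd : ℕ → ℚ
ratioProd zero = ℚ.1ℚ
ratioProd (suc n) =
  if isP5 (suc n) then ((+ (suc n ∸ 2)) ℚ./ suc n) ℚ.* ratioProd n else ratioProd n

L : ℕ → ℕ
L P = prodP (λ p → p) P

Pm2 : ℕ → ℕ
Pm2 P = prodP (λ p → p ∸ 2) P

G : ℕ → ℕ
G zero = 1
G (suc x) = Pm2 x

Sfun : ℕ → ℚ
Sfun P = ½ ℚ.* ((+ L P) ℚ./ 1) ℚ.* (ℚ.1ℚ ℚ.- ratioProd P)

xfrac : ℕ → ℚ
xfrac P = ½ ℚ.* ratioProd P

toQ : ℕ → ℚ
toQ n = (+ n) ℚ./ 1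

{-# OPTIONS --safe #-}
-- For odd m ≥ 3q, m is a non-rank of the prime q ≥ 5 exactly when m ≡ ±4N(q/6) (mod q);
-- the second sign needs m ≥ 3q because that family starts at n = 1.  So from 3P on, the
-- remnants of S_P are the odd integers avoiding two residue classes modulo every prime
-- 5 ≤ q ≤ P.  This set is periodic with period 2L(P), and by the Chinese remainder theorem
-- it meets each period in ∏ (q − 2) integers.  The remnant count up to N therefore stays
-- within a constant of N ∏ (q − 2) / 2L(P), which gives the density.  The identities for S
-- and G are algebra on the products, and x decreases because each new prime multiplies
-- it by (q − 2)/q < 1.
module Submission where

open import Data.Bool using (Bool; true; false; T; not; _∧_; if_then_else_)
open import Data.Bool.Properties using (T-∧; T-≡)
open import Data.Empty using (⊥-elim)
open import Data.Integer as ℤ using (+[1+_]; -[1+_]; _⊖_)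
import Data.Integer.Properties as ℤ
open import Data.Nat
open import Data.Nat.DivMod
open import Data.Nat.Divisibility
open import Data.Nat.Primality
open import Data.Nat.Properties
open import Algebra.Properties.CommutativeSemigroup +-commutativeSemigroup
  using () renaming (interchange to +-interchange; x∙yz≈y∙xz to x+[y+z]≡y+[x+z])
open import Algebra.Properties.CommutativeSemigroup *-commutativeSemigroup
  using () renaming (x∙yz≈z∙yx to x*[y*z]≡z*[y*x])
open import Data.Product using (Σ; _×_; _,_; proj₁; proj₂; map₂)
open import Data.Rational as ℚ using (ℚ; mkℚ; ½; ↧ₙ_; toℚᵘ)
import Data.Rational.Properties as ℚ
open import Data.Rational.Solver using (module +-*-Solver)
open import Data.Rational.Unnormalised as ℚᵘ using (mkℚᵘ; *<*)
import Data.Rational.Unnormalised.Properties as ℚᵘ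
open import Data.Sum using (_⊎_; inj₁; inj₂; [_,_])
open import Data.Unit using (tt)
open import Function using (_∘_)
open import Function.Bundles using (_⇔_; mk⇔; Equivalence)
open import Relation.Binary.PropositionalEquality hiding ([_])
open import Relation.Nullary using (¬_; Dec; yes; no; contradiction; ¬?; _×-dec_; _⊎-dec_)
open import Relation.Nullary.Decidable using (map′; isYes; does-⇔; isYes≗does; T?; toWitness; fromWitness)

open import Defs

-- Finite sums and counting

sumBelow : (ℕ → ℕ) → ℕ → ℕ
sumBelow f zero = 0
sumBelow f (suc n) = f n + sumBelow f n

sumBelow-cong : ∀ {f g} n → (∀ i → i < n → f i ≡ g i) → sumBelow f n ≡ sumBelow g n
sumBelow-cong zero eq = refl
sumBelow-cong (suc n) eq = cong₂ _+_ (eq n ≤-refl) (sumBelow-cong n (λ i i<n → eq i (m<n⇒m<1+n i<n)))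

sumBelow-mono-≤ : ∀ {f g} n → (∀ i → i < n → f i ≤ g i) → sumBelow f n ≤ sumBelow g n
sumBelow-mono-≤ zero le = z≤n
sumBelow-mono-≤ (suc n) le = +-mono-≤ (le n ≤-refl) (sumBelow-mono-≤ n (λ i i<n → le i (m<n⇒m<1+n i<n)))

sumBelow-const : ∀ c n → sumBelow (λ _ → c) n ≡ n * c
sumBelow-const c zero = refl
sumBelow-const c (suc n) = cong (c +_) (sumBelow-const c n)

sumBelow-+ : ∀ (f g : ℕ → ℕ) n → sumBelow (λ i → f i + g i) n ≡ sumBelow f n + sumBelow g n
sumBelow-+ f g zero = refl
sumBelow-+ f g (suc n) = trans (cong (f n + g n +_) (sumBelow-+ f g n)) (+-interchange (f n) (g n) _ _)

sumBelow-*ˡ : ∀ c (f : ℕ → ℕ) n → sumBelow (λ i → c * f i) n ≡ c * sumBelow f n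
sumBelow-*ˡ c f zero = sym (*-zeroʳ c)
sumBelow-*ˡ c f (suc n) = trans (cong (c * f n +_) (sumBelow-*ˡ c f n)) (sym (*-distribˡ-+ c (f n) _))

sumBelow-*ʳ : ∀ (f : ℕ → ℕ) c n → sumBelow (λ i → f i * c) n ≡ sumBelow f n * c
sumBelow-*ʳ f c n = trans (sumBelow-cong n (λ i _ → *-comm (f i) c))
                          (trans (sumBelow-*ˡ c f n) (*-comm c _))

sumBelow-swap : ∀ (f : ℕ → ℕ → ℕ) m n →
  sumBelow (λ i → sumBelow (f i) n) m ≡ sumBelow (λ j → sumBelow (λ i → f i j) m) n
sumBelow-swap f zero n = sym (trans (sumBelow-const 0 n) (*-zeroʳ n))
sumBelow-swap f (suc m) n = trans (cong (sumBelow (f m) n +_) (sumBelow-swap f m n))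
                                  (sym (sumBelow-+ (f m) (λ j → sumBelow (λ i → f i j) m) n))

sumBelow-split : ∀ (f : ℕ → ℕ) m n → sumBelow f (m + n) ≡ sumBelow f m + sumBelow (λ i → f (m + i)) n
sumBelow-split f m zero = trans (cong (sumBelow f) (+-identityʳ m)) (sym (+-identityʳ _))
sumBelow-split f m (suc n) rewrite +-suc m n =
  trans (cong (f (m + n) +_) (sumBelow-split f m n)) (x+[y+z]≡y+[x+z] (f (m + n)) (sumBelow f m) _)

sumBelow-blocks : ∀ (f : ℕ → ℕ) m n →
                  sumBelow f (m * n) ≡ sumBelow (λ s → sumBelow (λ r → f (s * n + r)) n) m
sumBelow-blocks f zero n = refl
sumBelow-blocks f (suc m) n = begin
  sumBelow f (n + m * n)
    ≡⟨ cong (sumBelow f) (+-comm n (m * n)) ⟩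
  sumBelow f (m * n + n)
    ≡⟨ sumBelow-split f (m * n) n ⟩
  sumBelow f (m * n) + sumBelow (λ r → f (m * n + r)) n
    ≡⟨ +-comm (sumBelow f (m * n)) _ ⟩
  sumBelow (λ r → f (m * n + r)) n + sumBelow f (m * n)
    ≡⟨ cong (sumBelow (λ r → f (m * n + r)) n +_) (sumBelow-blocks f m n) ⟩
  sumBelow (λ s → sumBelow (λ r → f (s * n + r)) n) (suc m) ∎
  where open ≡-Reasoning

indicator : Bool → ℕ
indicator true = 1
indicator false = 0

indicator≤1 : ∀ b → indicator b ≤ 1
indicator≤1 true = ≤-refl
indicator≤1 false = z≤n

indicator-true : ∀ {b} → T b → indicator b ≡ 1
indicator-true {true} _ = refl

indicator-false : ∀ {b} → ¬ T b → indicator b ≡ 0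
indicator-false {true} ¬b = contradiction _ ¬b
indicator-false {false} _ = refl

indicator-∧ : ∀ a b → indicator (a ∧ b) ≡ indicator a * indicator b
indicator-∧ true b = sym (+-identityʳ _)
indicator-∧ false b = refl

sumBelow-point : ∀ (g : ℕ → ℕ) x n → x < n → sumBelow (λ u → indicator (x ≡ᵇ u) * g u) n ≡ g x
sumBelow-point g x (suc n) x<1+n with x ≟ n
... | yes refl = begin
  indicator (x ≡ᵇ x) * g x + sumBelow (λ u → indicator (x ≡ᵇ u) * g u) x
    ≡⟨ cong₂ _+_ (cong (_* g x) (indicator-true (≡⇒≡ᵇ x x refl)))
                 (trans (sumBelow-cong {g = λ _ → 0} x (λ u u<x → cong (_* g u) (indicator-false (x≢u u<x))))
                        (trans (sumBelow-const 0 x) (*-zeroʳ x))) ⟩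
  1 * g x + 0 ≡⟨ trans (+-identityʳ (1 * g x)) (*-identityˡ (g x)) ⟩
  g x ∎
  where
  open ≡-Reasoning
  x≢u : ∀ {u} → u < x → ¬ T (x ≡ᵇ u)
  x≢u u<x t = <-irrefl (sym (≡ᵇ⇒≡ x _ t)) u<x
... | no x≢n = trans (cong (λ c → c * g n + sumBelow (λ u → indicator (x ≡ᵇ u) * g u) n)
                           (indicator-false (x≢n ∘ ≡ᵇ⇒≡ x n)))
                     (sumBelow-point g x n (≤∧≢⇒< (≤-pred x<1+n) x≢n))

sumBelow≡n⇒all≡1 : ∀ (c : ℕ → ℕ) n → (∀ i → i < n → c i ≤ 1) → sumBelow c n ≡ n →
                   ∀ i → i < n → c i ≡ 1
sumBelow≡n⇒all≡1 c (suc n) c≤1 total i i<1+n with c n in cₙ | c≤1 n ≤-refl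
... | 0 | _ = contradiction total (<⇒≢ (s≤s rest≤n))
  where
  rest≤n : sumBelow c n ≤ n
  rest≤n = ≤-trans (sumBelow-mono-≤ n (λ j j<n → c≤1 j (m<n⇒m<1+n j<n)))
                   (≤-reflexive (trans (sumBelow-const 1 n) (*-identityʳ n)))
... | 2+ _ | s≤s ()
... | 1 | _ with i ≟ n
...   | yes refl = cₙ
...   | no i≢n = sumBelow≡n⇒all≡1 c n (λ j j<n → c≤1 j (m<n⇒m<1+n j<n)) (suc-injective total)
                                   i (≤∧≢⇒< (≤-pred i<1+n) i≢n)

InjectiveBelow : (ℕ → ℕ) → ℕ → Set
InjectiveBelow f n = ∀ {s t} → s < n → t < n → f s ≡ f t → s ≡ t

count : (ℕ → Bool) → ℕ → ℕ
count p = sumBelow (λ i → indicator (p i))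

count-split : ∀ (f : ℕ → Bool) m n → count f (m + n) ≡ count f m + count (λ i → f (m + i)) n
count-split f = sumBelow-split (λ i → indicator (f i))

count≤n : ∀ (p : ℕ → Bool) n → count p n ≤ n
count≤n p n = ≤-trans (sumBelow-mono-≤ n (λ i _ → indicator≤1 (p i)))
                      (≤-reflexive (trans (sumBelow-const 1 n) (*-identityʳ n)))

count-point : ∀ x n → x < n → count (λ u → x ≡ᵇ u) n ≡ 1
count-point x n x<n = trans (sumBelow-cong n (λ u _ → sym (*-identityʳ (indicator (x ≡ᵇ u)))))
                            (sumBelow-point (λ _ → 1) x n x<n)

count-preimage≤1 : ∀ (f : ℕ → ℕ) n u → InjectiveBelow f n → count (λ s → f s ≡ᵇ u) n ≤ 1
count-preimage≤1 f zero u inj = z≤n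
count-preimage≤1 f (suc n) u inj with f n ≟ u
... | no fₙ≢u = subst (_≤ 1) (sym (cong (_+ count (λ s → f s ≡ᵇ u) n)
                                         (indicator-false (fₙ≢u ∘ ≡ᵇ⇒≡ (f n) u))))
                      (count-preimage≤1 f n u (λ s<n t<n → inj (m<n⇒m<1+n s<n) (m<n⇒m<1+n t<n)))
... | yes refl = ≤-reflexive (cong₂ _+_ (indicator-true (≡⇒≡ᵇ (f n) (f n) refl)) none)
  where
  none : count (λ s → f s ≡ᵇ f n) n ≡ 0
  none = trans (sumBelow-cong {g = λ _ → 0} n (λ s s<n → indicator-false
                 (λ t → <-irrefl (inj (m<n⇒m<1+n s<n) ≤-refl (≡ᵇ⇒≡ (f s) (f n) t)) s<n)))
               (trans (sumBelow-const 0 n) (*-zeroʳ n))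

sumBelow-reindex : ∀ (f g : ℕ → ℕ) n → (∀ s → s < n → f s < n) → InjectiveBelow f n →
                   sumBelow (λ s → g (f s)) n ≡ sumBelow g n
sumBelow-reindex f g n f<n inj = begin
  sumBelow (λ s → g (f s)) n
    ≡⟨ sumBelow-cong n (λ s s<n → sym (sumBelow-point g (f s) n (f<n s s<n))) ⟩
  sumBelow (λ s → sumBelow (λ u → indicator (f s ≡ᵇ u) * g u) n) n
    ≡⟨ sumBelow-swap (λ s u → indicator (f s ≡ᵇ u) * g u) n n ⟩
  sumBelow (λ u → sumBelow (λ s → indicator (f s ≡ᵇ u) * g u) n) n
    ≡⟨ sumBelow-cong n (λ u _ → sumBelow-*ʳ (λ s → indicator (f s ≡ᵇ u)) (g u) n) ⟩
  sumBelow (λ u → preimages u * g u) n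
    ≡⟨ sumBelow-cong n (λ u u<n → trans (cong (_* g u) (preimages≡1 u u<n)) (*-identityˡ (g u))) ⟩
  sumBelow g n ∎
  where
  open ≡-Reasoning
  preimages : ℕ → ℕ
  preimages u = count (λ s → f s ≡ᵇ u) n

  total : sumBelow preimages n ≡ n
  total = begin
    sumBelow preimages n
      ≡⟨ sumBelow-swap (λ u s → indicator (f s ≡ᵇ u)) n n ⟩
    sumBelow (λ s → sumBelow (λ u → indicator (f s ≡ᵇ u)) n) n
      ≡⟨ sumBelow-cong n (λ s s<n → count-point (f s) n (f<n s s<n)) ⟩
    sumBelow (λ _ → 1) n
      ≡⟨ trans (sumBelow-const 1 n) (*-identityʳ n) ⟩
    n ∎

  preimages≡1 : ∀ u → u < n → preimages u ≡ 1
  preimages≡1 = sumBelow≡n⇒all≡1 preimages n (λ u _ → count-preimage≤1 f n u inj) total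

-- Counting residues modulo a product

%≡%⇒∣∸ : ∀ x y a .{{_ : NonZero a}} → x % a ≡ y % a → a ∣ y ∸ x
%≡%⇒∣∸ x y a eq = divides (y / a ∸ x / a) (begin
  y ∸ x                                     ≡⟨ cong₂ _∸_ (m≡m%n+[m/n]*n y a) (m≡m%n+[m/n]*n x a) ⟩
  (y % a + y / a * a) ∸ (x % a + x / a * a) ≡⟨ cong (λ z → (z + y / a * a) ∸ (x % a + x / a * a)) (sym eq) ⟩
  (x % a + y / a * a) ∸ (x % a + x / a * a) ≡⟨ [m+n]∸[m+o]≡n∸o (x % a) _ _ ⟩
  y / a * a ∸ x / a * a                     ≡⟨ *-distribʳ-∸ a (y / a) (x / a) ⟨
  (y / a ∸ x / a) * a                       ∎)
  where open ≡-Reasoning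

∣∧<⇒≡0 : ∀ {a d} → a ∣ d → d < a → d ≡ 0
∣∧<⇒≡0 {d = zero} _ _ = refl
∣∧<⇒≡0 {d = suc _} a∣d d<a = contradiction a∣d (>⇒∤ d<a)

private
  affine-injective-≤ : ∀ a b r .{{_ : NonZero a}} → Prime a → ¬ a ∣ b → ∀ {s t} → s ≤ t → t < a →
                       (r + s * b) % a ≡ (r + t * b) % a → s ≡ t
  affine-injective-≤ a b r pa a∤b {s} {t} s≤t t<a eq with euclidsLemma (t ∸ s) b pa a∣[t∸s]b
    where
    a∣[t∸s]b : a ∣ (t ∸ s) * b
    a∣[t∸s]b = subst (a ∣_) (trans ([m+n]∸[m+o]≡n∸o r (t * b) (s * b)) (sym (*-distribʳ-∸ b t s)))
                              (%≡%⇒∣∸ _ _ a eq)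
  ... | inj₁ a∣t∸s = ≤-antisym s≤t (m∸n≡0⇒m≤n (∣∧<⇒≡0 a∣t∸s (≤-<-trans (m∸n≤m t s) t<a)))
  ... | inj₂ a∣b = contradiction a∣b a∤b

affine-injective : ∀ a b r .{{_ : NonZero a}} → Prime a → ¬ a ∣ b →
                   InjectiveBelow (λ s → (r + s * b) % a) a
affine-injective a b r pa a∤b {s} {t} s<a t<a eq with ≤-total s t
... | inj₁ s≤t = affine-injective-≤ a b r pa a∤b s≤t t<a eq
... | inj₂ t≤s = sym (affine-injective-≤ a b r pa a∤b t≤s s<a (sym eq))

count-crt : ∀ a b .{{_ : NonZero a}} .{{_ : NonZero b}} → Prime a → ¬ a ∣ b → (G F : ℕ → Bool) →
            count (λ m → G (m % a) ∧ F (m % b)) (a * b) ≡ count G a * count F b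
count-crt a b pa a∤b G F = begin
  count (λ m → G (m % a) ∧ F (m % b)) (a * b)
    ≡⟨ sumBelow-blocks _ a b ⟩
  sumBelow (λ s → sumBelow (λ r → indicator (G ((s * b + r) % a) ∧ F ((s * b + r) % b))) b) a
    ≡⟨ sumBelow-cong a (λ s _ → sumBelow-cong b (λ r r<b → separate s r r<b)) ⟩
  sumBelow (λ s → sumBelow (λ r → indicator (G ((r + s * b) % a)) * indicator (F r)) b) a
    ≡⟨ sumBelow-swap (λ s r → indicator (G ((r + s * b) % a)) * indicator (F r)) a b ⟩
  sumBelow (λ r → sumBelow (λ s → indicator (G ((r + s * b) % a)) * indicator (F r)) a) b
    ≡⟨ sumBelow-cong b (λ r _ → sumBelow-*ʳ (λ s → indicator (G ((r + s * b) % a))) (indicator (F r)) a) ⟩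
  sumBelow (λ r → count (λ s → G ((r + s * b) % a)) a * indicator (F r)) b
    ≡⟨ sumBelow-cong b (λ r _ → cong (_* indicator (F r)) (permuted r)) ⟩
  sumBelow (λ r → count G a * indicator (F r)) b
    ≡⟨ sumBelow-*ˡ (count G a) (λ r → indicator (F r)) b ⟩
  count G a * count F b ∎
  where
  open ≡-Reasoning
  separate : ∀ s r → r < b → indicator (G ((s * b + r) % a) ∧ F ((s * b + r) % b))
                             ≡ indicator (G ((r + s * b) % a)) * indicator (F r)
  separate s r r<b = begin
    indicator (G ((s * b + r) % a) ∧ F ((s * b + r) % b))
      ≡⟨ cong (λ m → indicator (G (m % a) ∧ F (m % b))) (+-comm (s * b) r) ⟩
    indicator (G ((r + s * b) % a) ∧ F ((r + s * b) % b))
      ≡⟨ cong (λ u → indicator (G ((r + s * b) % a) ∧ F u)) (trans ([m+kn]%n≡m%n r s b) (m<n⇒m%n≡m r<b)) ⟩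
    indicator (G ((r + s * b) % a) ∧ F r)
      ≡⟨ indicator-∧ (G ((r + s * b) % a)) (F r) ⟩
    indicator (G ((r + s * b) % a)) * indicator (F r) ∎
  permuted : ∀ r → count (λ s → G ((r + s * b) % a)) a ≡ count G a
  permuted r = sumBelow-reindex (λ s → (r + s * b) % a) (λ u → indicator (G u)) a
                                (λ s _ → m%n<n _ a) (affine-injective a b r pa a∤b)

count-avoiding-two : ∀ A B n → A ≢ B → A < n → B < n →
                     count (λ u → not (A ≡ᵇ u) ∧ not (B ≡ᵇ u)) n ≡ n ∸ 2
count-avoiding-two A B n A≢B A<n B<n = begin
  count avoids n                   ≡⟨ m+n∸n≡m (count avoids n) 2 ⟨
  count avoids n + 2 ∸ 2           ≡⟨ cong (_∸ 2) partition ⟩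
  n ∸ 2                            ∎
  where
  open ≡-Reasoning
  avoids : ℕ → Bool
  avoids u = not (A ≡ᵇ u) ∧ not (B ≡ᵇ u)

  exactly-one : ∀ u → indicator (avoids u) + (indicator (A ≡ᵇ u) + indicator (B ≡ᵇ u)) ≡ 1
  exactly-one u with A ≡ᵇ u in A≡u | B ≡ᵇ u in B≡u
  ... | false | false = refl
  ... | false | true = refl
  ... | true | false = refl
  ... | true | true = contradiction (trans (≡ᵇ⇒≡ A u (subst T (sym A≡u) _))
                                           (sym (≡ᵇ⇒≡ B u (subst T (sym B≡u) _)))) A≢B

  partition : count avoids n + 2 ≡ n
  partition = begin
    count avoids n + 2
      ≡⟨ cong (count avoids n +_) (cong₂ _+_ (count-point A n A<n) (count-point B n B<n)) ⟨
    count avoids n + (count (A ≡ᵇ_) n + count (B ≡ᵇ_) n)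
      ≡⟨ cong (count avoids n +_) (sumBelow-+ _ _ n) ⟨
    count avoids n + sumBelow (λ u → indicator (A ≡ᵇ u) + indicator (B ≡ᵇ u)) n
      ≡⟨ sumBelow-+ _ _ n ⟨
    sumBelow (λ u → indicator (avoids u) + (indicator (A ≡ᵇ u) + indicator (B ≡ᵇ u))) n
      ≡⟨ sumBelow-cong n (λ u _ → exactly-one u) ⟩
    sumBelow (λ _ → 1) n
      ≡⟨ trans (sumBelow-const 1 n) (*-identityʳ n) ⟩
    n ∎

-- Eventually periodic counting functions

module _ (g : ℕ → Bool) (M : ℕ) (periodic : ∀ i → g (M + i) ≡ g i) where

  private
    count-shiftʳ : ∀ n → count (λ i → g (M + i)) n ≡ count g n
    count-shiftʳ n = sumBelow-cong n (λ i _ → cong indicator (periodic i))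

  count-periodic : ∀ t s → count g (t * M + s) ≡ t * count g M + count g s
  count-periodic zero s = refl
  count-periodic (suc t) s = begin
    count g (M + t * M + s)                          ≡⟨ cong (count g) (+-assoc M (t * M) s) ⟩
    count g (M + (t * M + s))                        ≡⟨ count-split g M (t * M + s) ⟩
    count g M + count (λ i → g (M + i)) (t * M + s)  ≡⟨ cong (count g M +_) (count-shiftʳ (t * M + s)) ⟩
    count g M + count g (t * M + s)                  ≡⟨ cong (count g M +_) (count-periodic t s) ⟩
    count g M + (t * count g M + count g s)          ≡⟨ +-assoc (count g M) _ _ ⟨
    suc t * count g M + count g s                    ∎
    where open ≡-Reasoning

  count-rotate : count (λ i → g (suc i)) M ≡ count g M
  count-rotate = +-cancelˡ-≡ (count g 1) _ _ (begin
    count g 1 + count (λ i → g (suc i)) M   ≡⟨ count-split g 1 M ⟨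
    count g (1 + M)                          ≡⟨ cong (count g) (+-comm 1 M) ⟩
    count g (M + 1)                          ≡⟨ count-split g M 1 ⟩
    count g M + count (λ i → g (M + i)) 1    ≡⟨ cong (count g M +_) (count-shiftʳ 1) ⟩
    count g M + count g 1                    ≡⟨ +-comm (count g M) (count g 1) ⟩
    count g 1 + count g M                    ∎)
    where open ≡-Reasoning

  ∣M*count-C*N∣≤M*M : .{{_ : NonZero M}} → ∀ N → ∣ M * count g N - count g M * N ∣ ≤ M * M
  ∣M*count-C*N∣≤M*M N = begin
    ∣ M * count g N - C * N ∣
      ≡⟨ cong₂ ∣_-_∣ (cong (M *_) count-N) (cong (C *_) N≡) ⟩
    ∣ M * (t * C + count g s) - C * (t * M + s) ∣
      ≡⟨ cong₂ ∣_-_∣ (*-distribˡ-+ M (t * C) _) (*-distribˡ-+ C (t * M) s) ⟩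
    ∣ M * (t * C) + M * count g s - C * (t * M) + C * s ∣
      ≡⟨ cong (λ x → ∣ x + M * count g s - C * (t * M) + C * s ∣) (x*[y*z]≡z*[y*x] M t C) ⟩
    ∣ C * (t * M) + M * count g s - C * (t * M) + C * s ∣
      ≡⟨ ∣m+n-m+o∣≡∣n-o∣ (C * (t * M)) _ _ ⟩
    ∣ M * count g s - C * s ∣
      ≤⟨ ∣m-n∣≤m⊔n (M * count g s) (C * s) ⟩
    M * count g s ⊔ C * s
      ≤⟨ ⊔-lub (*-monoʳ-≤ M (≤-trans (count≤n g s) s≤M)) (*-mono-≤ (count≤n g M) s≤M) ⟩
    M * M ∎
    where
    open ≤-Reasoning
    C t s : ℕ
    C = count g M
    t = N / M
    s = N % M
    s≤M : s ≤ M
    s≤M = <⇒≤ (m%n<n N M)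
    N≡ : N ≡ t * M + s
    N≡ = trans (m≡m%n+[m/n]*n N M) (+-comm s (t * M))
    count-N : count g N ≡ t * C + count g s
    count-N = trans (cong (count g) N≡) (count-periodic t s)

∣count-count∣≤ : ∀ (h g : ℕ → Bool) B → (∀ i → B ≤ i → h i ≡ g i) →
                 ∀ N → ∣ count h N - count g N ∣ ≤ B
∣count-count∣≤ h g B agree N with ≤-total N B
... | inj₁ N≤B = ≤-trans (∣m-n∣≤m⊔n (count h N) (count g N)) (⊔-lub (≤-trans (count≤n h N) N≤B)
                                                                    (≤-trans (count≤n g N) N≤B))
... | inj₂ B≤N = begin
  ∣ count h N - count g N ∣                 ≡⟨ cong₂ ∣_-_∣ (split h (λ i → agree (B + i) (m≤m+n B i)))
                                                           (split g (λ _ → refl)) ⟩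
  ∣ count h B + tail - (count g B + tail) ∣ ≡⟨ cong₂ ∣_-_∣ (+-comm (count h B) tail) (+-comm (count g B) tail) ⟩
  ∣ tail + count h B - tail + count g B ∣   ≡⟨ ∣m+n-m+o∣≡∣n-o∣ tail _ _ ⟩
  ∣ count h B - count g B ∣                 ≤⟨ ∣m-n∣≤m⊔n (count h B) (count g B) ⟩
  count h B ⊔ count g B                     ≤⟨ ⊔-lub (count≤n h B) (count≤n g B) ⟩
  B                                         ∎
  where
  open ≤-Reasoning
  tail : ℕ
  tail = count (λ i → g (B + i)) (N ∸ B)
  split : ∀ (f : ℕ → Bool) → (∀ i → f (B + i) ≡ g (B + i)) → count f N ≡ count f B + tail
  split f f≡g = begin-equality
    count f N                                         ≡⟨ cong (count f) (m+[n∸m]≡n B≤N) ⟨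
    count f (B + (N ∸ B))                             ≡⟨ count-split f B (N ∸ B) ⟩
    count f B + count (λ i → f (B + i)) (N ∸ B)       ≡⟨ cong (count f B +_)
                                                             (sumBelow-cong (N ∸ B) (λ i _ → cong indicator (f≡g i))) ⟩
    count f B + tail                                  ∎

∣M*count-C*N∣≤M*[M+B] : ∀ (h g : ℕ → Bool) M B .{{_ : NonZero M}} → (∀ i → g (M + i) ≡ g i) →
                        (∀ i → B ≤ i → h i ≡ g i) → ∀ N → ∣ M * count h N - count g M * N ∣ ≤ M * (M + B)
∣M*count-C*N∣≤M*[M+B] h g M B periodic agree N = begin
  ∣ M * count h N - C * N ∣
    ≤⟨ ∣-∣-triangle (M * count h N) (M * count g N) (C * N) ⟩
  ∣ M * count h N - M * count g N ∣ + ∣ M * count g N - C * N ∣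
    ≡⟨ cong (_+ ∣ M * count g N - C * N ∣) (*-distribˡ-∣-∣ M (count h N) (count g N)) ⟨
  M * ∣ count h N - count g N ∣ + ∣ M * count g N - C * N ∣
    ≤⟨ +-mono-≤ (*-monoʳ-≤ M (∣count-count∣≤ h g B agree N)) (∣M*count-C*N∣≤M*M g M periodic N) ⟩
  M * B + M * M
    ≡⟨ trans (+-comm (M * B) (M * M)) (sym (*-distribˡ-+ M M B)) ⟩
  M * (M + B) ∎
  where
  open ≤-Reasoning
  C : ℕ
  C = count g M

-- Non-ranks as residue classes

odd⇒%2≡1 : ∀ {k} → Odd k → k % 2 ≡ 1
odd⇒%2≡1 (j , refl) = trans (cong (_% 2) (trans (+-comm (2 * j) 1) (cong (1 +_) (*-comm 2 j))))
                            ([m+kn]%n≡m%n 1 j 2)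

%2≡1⇒odd : ∀ {k} → k % 2 ≡ 1 → Odd k
%2≡1⇒odd {k} k%2≡1 = k / 2 , (begin
  k                 ≡⟨ m≡m%n+[m/n]*n k 2 ⟩
  k % 2 + k / 2 * 2 ≡⟨ cong (_+ k / 2 * 2) k%2≡1 ⟩
  1 + k / 2 * 2     ≡⟨ +-comm 1 _ ⟩
  k / 2 * 2 + 1     ≡⟨ cong (_+ 1) (*-comm (k / 2) 2) ⟩
  2 * (k / 2) + 1   ∎)
  where open ≡-Reasoning

*-odd-%2 : ∀ k q → q % 2 ≡ 1 → (k * q) % 2 ≡ k % 2
*-odd-%2 k q q%2≡1 = begin
  (k * q) % 2               ≡⟨ %-distribˡ-* k q 2 ⟩
  (k % 2 * (q % 2)) % 2     ≡⟨ cong (λ r → (k % 2 * r) % 2) q%2≡1 ⟩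
  (k % 2 * 1) % 2           ≡⟨ cong (_% 2) (*-identityʳ (k % 2)) ⟩
  k % 2 % 2                 ≡⟨ m%n%n≡m%n k 2 ⟩
  k % 2                     ∎
  where open ≡-Reasoning

prime≥5⇒odd : ∀ {q} → Prime q → 5 ≤ q → q % 2 ≡ 1
prime≥5⇒odd {q} pq 5≤q with q % 2 in q%2 | m%n<n q 2
... | 0 | _ with prime⇒irreducible pq (m%n≡0⇒n∣m q 2 q%2)
...   | inj₁ ()
...   | inj₂ refl = contradiction 5≤q (λ { (s≤s (s≤s ())) })
prime≥5⇒odd pq 5≤q | 1 | _ = refl
prime≥5⇒odd pq 5≤q | 2+ _ | s≤s (s≤s ())

2∣off : ∀ q → 2 ∣ off q
2∣off q = ∣m⇒∣m*n (nearest q 6) (divides 2 refl)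

off-positive : ∀ {q} → 5 ≤ q → 0 < off q
off-positive {q} 5≤q =
  *-monoʳ-< 4 (m≥n⇒m/n>0 {2 * q + 6} {12} (≤-trans (m≤m+n 12 4) (+-monoˡ-≤ 6 (*-monoʳ-≤ 2 5≤q))))

-- 3 · 4N(q/6) ≤ 2q + 6, which is below 3q once q > 6.
off<q : ∀ {q} → 5 ≤ q → off q < q
off<q {4} (s≤s (s≤s (s≤s (s≤s ()))))
off<q {5} _ = ≤-refl
off<q {6} _ = n≤1+n 5
off<q {q@(suc (suc (suc (suc (suc (suc (suc _)))))))} _ = *-cancelˡ-< 3 (off q) q (begin-strict
  3 * (4 * nearest q 6)   ≡⟨ trans (sym (*-assoc 3 4 (nearest q 6))) (*-comm 12 (nearest q 6)) ⟩
  nearest q 6 * 12        ≤⟨ m/n*n≤m (2 * q + 6) 12 ⟩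
  2 * q + 6               <⟨ +-monoʳ-< (2 * q) (s≤s (s≤s (s≤s (s≤s (s≤s (s≤s (s≤s z≤n))))))) ⟩
  2 * q + q               ≡⟨ +-comm (2 * q) q ⟩
  3 * q                   ∎)
  where open ≤-Reasoning

NonRank⇒residue : ∀ q m .{{_ : NonZero q}} → 5 ≤ q → NonRank q m →
                  m % q ≡ off q ⊎ m % q ≡ q ∸ off q
NonRank⇒residue q m 5≤q (n , inj₁ refl) = inj₁ (begin
  ((2 * n + 1) * q + off q) % q ≡⟨ cong (_% q) (+-comm ((2 * n + 1) * q) (off q)) ⟩
  (off q + (2 * n + 1) * q) % q ≡⟨ [m+kn]%n≡m%n (off q) (2 * n + 1) q ⟩
  off q % q                     ≡⟨ m<n⇒m%n≡m (off<q 5≤q) ⟩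
  off q                         ∎)
  where open ≡-Reasoning
NonRank⇒residue q m 5≤q (n , inj₂ (_ , m+o≡[2n+1]q)) = inj₂ (begin
  m % q                         ≡⟨ cong (_% q) m≡ ⟩
  (q ∸ off q + 2 * n * q) % q   ≡⟨ [m+kn]%n≡m%n (q ∸ off q) (2 * n) q ⟩
  (q ∸ off q) % q               ≡⟨ m<n⇒m%n≡m (∸-monoʳ-< (off-positive 5≤q) (<⇒≤ (off<q 5≤q))) ⟩
  q ∸ off q                     ∎)
  where
  open ≡-Reasoning
  m≡ : m ≡ q ∸ off q + 2 * n * q
  m≡ = +-cancelʳ-≡ (off q) _ _ (begin
    m + off q                        ≡⟨ m+o≡[2n+1]q ⟩
    (2 * n + 1) * q                  ≡⟨ *-distribʳ-+ q (2 * n) 1 ⟩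
    2 * n * q + 1 * q                ≡⟨ cong (2 * n * q +_) (*-identityˡ q) ⟩
    2 * n * q + q                    ≡⟨ cong (2 * n * q +_) (m∸n+n≡m (<⇒≤ (off<q 5≤q))) ⟨
    2 * n * q + (q ∸ off q + off q)  ≡⟨ +-assoc (2 * n * q) _ _ ⟨
    2 * n * q + (q ∸ off q) + off q  ≡⟨ cong (_+ off q) (+-comm (2 * n * q) _) ⟩
    q ∸ off q + 2 * n * q + off q    ∎)

module _ (q m : ℕ) .{{_ : NonZero q}} (pq : Prime q) (5≤q : 5 ≤ q) (odd-m : Odd m) where

  private
    j : ℕ
    j = m / q

    m≡ : m ≡ m % q + j * q
    m≡ = m≡m%n+[m/n]*n m q

  residue-off⇒NonRank : m % q ≡ off q → NonRank q m
  residue-off⇒NonRank m%q≡o = n , inj₁ (begin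
    m                      ≡⟨ m≡ ⟩
    m % q + j * q          ≡⟨ cong (_+ j * q) m%q≡o ⟩
    off q + j * q          ≡⟨ +-comm (off q) (j * q) ⟩
    j * q + off q          ≡⟨ cong (λ k → k * q + off q) j≡2n+1 ⟩
    (2 * n + 1) * q + off q ∎)
    where
    open ≡-Reasoning
    j%2≡1 : j % 2 ≡ 1
    j%2≡1 = begin
      j % 2                 ≡⟨ *-odd-%2 j q (prime≥5⇒odd pq 5≤q) ⟨
      j * q % 2             ≡⟨ %-remove-+ˡ (j * q) (2∣off q) ⟨
      (off q + j * q) % 2   ≡⟨ cong (λ r → (r + j * q) % 2) m%q≡o ⟨
      (m % q + j * q) % 2   ≡⟨ cong (_% 2) m≡ ⟨
      m % 2                 ≡⟨ odd⇒%2≡1 odd-m ⟩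
      1                     ∎
    n : ℕ
    n = proj₁ (%2≡1⇒odd {j} j%2≡1)
    j≡2n+1 : j ≡ 2 * n + 1
    j≡2n+1 = proj₂ (%2≡1⇒odd {j} j%2≡1)

  residue-q∸off⇒NonRank : 3 * q ≤ m → m % q ≡ q ∸ off q → NonRank q m
  residue-q∸off⇒NonRank 3q≤m m%q≡q∸o = n , inj₂ (1≤n , m+o≡[2n+1]q)
    where
    open ≡-Reasoning
    m+o≡[1+j]q : m + off q ≡ (1 + j) * q
    m+o≡[1+j]q = begin
      m + off q                    ≡⟨ cong (_+ off q) (trans m≡ (cong (_+ j * q) m%q≡q∸o)) ⟩
      q ∸ off q + j * q + off q    ≡⟨ +-assoc (q ∸ off q) _ _ ⟩
      q ∸ off q + (j * q + off q)  ≡⟨ cong (q ∸ off q +_) (+-comm (j * q) (off q)) ⟩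
      q ∸ off q + (off q + j * q)  ≡⟨ +-assoc (q ∸ off q) _ _ ⟨
      q ∸ off q + off q + j * q    ≡⟨ cong (_+ j * q) (m∸n+n≡m (<⇒≤ (off<q 5≤q))) ⟩
      q + j * q                    ∎
    [1+j]%2≡1 : (1 + j) % 2 ≡ 1
    [1+j]%2≡1 = begin
      (1 + j) % 2                  ≡⟨ *-odd-%2 (1 + j) q (prime≥5⇒odd pq 5≤q) ⟨
      (1 + j) * q % 2              ≡⟨ cong (_% 2) m+o≡[1+j]q ⟨
      (m + off q) % 2              ≡⟨ %-remove-+ʳ m (2∣off q) ⟩
      m % 2                        ≡⟨ odd⇒%2≡1 odd-m ⟩
      1                            ∎
    n : ℕ
    n = proj₁ (%2≡1⇒odd {1 + j} [1+j]%2≡1)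
    m+o≡[2n+1]q : m + off q ≡ (2 * n + 1) * q
    m+o≡[2n+1]q = trans m+o≡[1+j]q (cong (_* q) (proj₂ (%2≡1⇒odd {1 + j} [1+j]%2≡1)))
    q<m+o : q < m + off q
    q<m+o = ≤-trans (subst (q <_) (*-comm q 3) (m<m*n q 3 (s≤s (s≤s z≤n))))
                    (≤-trans 3q≤m (m≤m+n m (off q)))
    1≤n : 1 ≤ n
    1≤n = n≢0⇒n>0 λ n≡0 → <-irrefl (sym (trans m+o≡[2n+1]q
                    (trans (cong (λ k → (2 * k + 1) * q) n≡0) (+-identityʳ q)))) q<m+o

-- Deciding remnants

Odd? : ∀ m → Dec (Odd m)
Odd? m = map′ %2≡1⇒odd odd⇒%2≡1 (m % 2 ≟ 1)

NonRank? : ∀ q m .{{_ : NonZero q}} → Dec (NonRank q m)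
NonRank? q m = map′ (λ (n , _ , nr) → n , nr) (λ (n , nr) → n , bound n nr , nr)
                    (anyUpTo? (λ n → (m ≟ (2 * n + 1) * q + off q)
                                     ⊎-dec ((1 ≤? n) ×-dec (m + off q ≟ (2 * n + 1) * q)))
                              (suc (m + off q)))
  where
  n≤[2n+1]q : ∀ n → n ≤ (2 * n + 1) * q
  n≤[2n+1]q n = ≤-trans (≤-trans (m≤m+n n (n + 0)) (m≤m+n (2 * n) 1)) (m≤m*n (2 * n + 1) q)
  bound : ∀ n → (m ≡ (2 * n + 1) * q + off q) ⊎ ((1 ≤ n) × (m + off q ≡ (2 * n + 1) * q)) →
          n < suc (m + off q)
  bound n (inj₁ refl) = s≤s (≤-trans (≤-trans (n≤[2n+1]q n) (m≤m+n _ (off q))) (m≤m+n m (off q)))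
  bound n (inj₂ (_ , m+o≡)) = s≤s (subst (n ≤_) (sym m+o≡) (n≤[2n+1]q n))

InS? : ∀ P m → Dec (InS P m)
InS? P m = map′ (λ (q , q<1+P , pq , 5≤q , nr) → q , pq , 5≤q , ≤-pred q<1+P , nr)
                (λ (q , pq , 5≤q , q≤P , nr) → q , s≤s q≤P , pq , 5≤q , nr)
                (anyUpTo? candidate? (suc P))
  where
  candidate? : ∀ q → Dec (Prime q × 5 ≤ q × NonRank q m)
  candidate? zero = no (λ ())
  candidate? q@(suc _) = prime? q ×-dec (5 ≤? q ×-dec NonRank? q m)

Remnant? : ∀ P m → Dec (Remnant P m)
Remnant? P m = Odd? m ×-dec ¬? (InS? P m)

count-Remnant : ∀ P N → CountIs (Remnant P) N (count (λ i → isYes (Remnant? P (suc i))) N)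
count-Remnant P zero = c-zero
count-Remnant P (suc N) with Remnant? P (suc N)
... | yes r = c-yes r (count-Remnant P N)
... | no ¬r = c-no ¬r (count-Remnant P N)

-- The sieve

isP5-sound : ∀ {p} → isP5 p ≡ true → 5 ≤ p × Prime p
isP5-sound {p} eq = toWitness {a? = 5 ≤? p} (proj₁ both) , toWitness {a? = prime? p} (proj₂ both)
  where
  both : T (isYes (5 ≤? p)) × T (isYes (prime? p))
  both = Equivalence.to T-∧ (Equivalence.from T-≡ eq)

isP5-complete : ∀ {p} → 5 ≤ p → Prime p → isP5 p ≡ true
isP5-complete {p} 5≤p pp = Equivalence.to T-≡ (Equivalence.from (T-∧ {isYes (5 ≤? p)} {isYes (prime? p)})
                                               (fromWitness 5≤p , fromWitness pp))

avoids : ℕ → ℕ → Bool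
avoids q u = not (off q ≡ᵇ u) ∧ not (q ∸ off q ≡ᵇ u)

survives : ℕ → ℕ → Bool
survives zero m = true
survives (suc p) m = if isP5 (suc p) then avoids (suc p) (m % suc p) ∧ survives p m else survives p m

sieve : ℕ → ℕ → Bool
sieve P m = (m % 2 ≡ᵇ 1) ∧ survives P m

T-avoiding-two : ∀ A B u → T (not (A ≡ᵇ u) ∧ not (B ≡ᵇ u)) ⇔ (¬ (u ≡ A ⊎ u ≡ B))
T-avoiding-two A B u with A ≡ᵇ u in A≡u | B ≡ᵇ u in B≡u
... | true | _ = mk⇔ (λ ()) (λ ¬hit → ¬hit (inj₁ (sym (≡ᵇ⇒≡ A u (subst T (sym A≡u) tt)))))
... | false | true = mk⇔ (λ ()) (λ ¬hit → ¬hit (inj₂ (sym (≡ᵇ⇒≡ B u (subst T (sym B≡u) tt)))))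
... | false | false = mk⇔ (λ _ → [ miss A≡u , miss B≡u ]) (λ _ → tt)
  where
  miss : ∀ {C} → (C ≡ᵇ u) ≡ false → ¬ u ≡ C
  miss {C} C≢u refl = subst T C≢u (≡⇒≡ᵇ C C refl)

avoids⇔¬NonRank : ∀ q m .{{_ : NonZero q}} → Prime q → 5 ≤ q → Odd m → 3 * q ≤ m →
                  T (avoids q (m % q)) ⇔ (¬ NonRank q m)
avoids⇔¬NonRank q m pq 5≤q odd-m 3q≤m = mk⇔
  (λ t nr → Equivalence.to (T-avoiding-two _ _ (m % q)) t (NonRank⇒residue q m 5≤q nr))
  (λ ¬nr → Equivalence.from (T-avoiding-two _ _ (m % q))
     (λ r → ¬nr ([ residue-off⇒NonRank q m pq 5≤q odd-m
                 , residue-q∸off⇒NonRank q m pq 5≤q odd-m 3q≤m ] r)))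

¬InS-zero : ∀ {m} → ¬ InS 0 m
¬InS-zero (_ , _ , 5≤q , q≤0 , _) = contradiction (≤-trans 5≤q q≤0) λ ()

InS-weaken : ∀ {p m} → InS p m → InS (suc p) m
InS-weaken (q , pq , 5≤q , q≤p , nr) = q , pq , 5≤q , m≤n⇒m≤1+n q≤p , nr

InS-suc⁻ : ∀ {p m} → InS (suc p) m → (isP5 (suc p) ≡ true × NonRank (suc p) m) ⊎ InS p m
InS-suc⁻ {p} (q , pq , 5≤q , q≤1+p , nr) with q ≟ suc p
... | yes refl = inj₁ (isP5-complete 5≤q pq , nr)
... | no q≢1+p = inj₂ (q , pq , 5≤q , ≤-pred (≤∧≢⇒< q≤1+p q≢1+p) , nr)

survives⇔¬InS : ∀ P m → Odd m → 3 * P ≤ m → T (survives P m) ⇔ (¬ InS P m)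
survives⇔¬InS zero m odd-m _ = mk⇔ (λ _ → ¬InS-zero) (λ _ → tt)
survives⇔¬InS (suc p) m odd-m 3[1+p]≤m with isP5 (suc p) in q-eq
... | false = mk⇔
  (λ t → [ (λ (q-eq′ , _) → contradiction (trans (sym q-eq) q-eq′) λ ()) , Equivalence.to below t ] ∘ InS-suc⁻)
  (λ ¬s → Equivalence.from below (¬s ∘ InS-weaken))
  where
  below : T (survives p m) ⇔ (¬ InS p m)
  below = survives⇔¬InS p m odd-m (≤-trans (*-monoʳ-≤ 3 (n≤1+n p)) 3[1+p]≤m)
... | true = mk⇔
  (λ t → let (t-avoid , t-below) = Equivalence.to T-∧ t in
         [ (λ (_ , nr) → Equivalence.to at-q t-avoid nr) , Equivalence.to below t-below ] ∘ InS-suc⁻)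
  (λ ¬s → Equivalence.from T-∧ ( Equivalence.from at-q (λ nr → ¬s (suc p , pq , 5≤q , ≤-refl , nr))
                               , Equivalence.from below (¬s ∘ InS-weaken)))
  where
  below : T (survives p m) ⇔ (¬ InS p m)
  below = survives⇔¬InS p m odd-m (≤-trans (*-monoʳ-≤ 3 (n≤1+n p)) 3[1+p]≤m)
  5≤q : 5 ≤ suc p
  5≤q = proj₁ (isP5-sound q-eq)
  pq : Prime (suc p)
  pq = proj₂ (isP5-sound q-eq)
  at-q : T (avoids (suc p) (m % suc p)) ⇔ (¬ NonRank (suc p) m)
  at-q = avoids⇔¬NonRank (suc p) m pq 5≤q odd-m 3[1+p]≤m

Remnant⇔sieve : ∀ P m → 3 * P ≤ m → Remnant P m ⇔ T (sieve P m)
Remnant⇔sieve P m 3P≤m = mk⇔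
  (λ (odd-m , ¬s) → Equivalence.from T-∧ ( ≡⇒≡ᵇ (m % 2) 1 (odd⇒%2≡1 odd-m)
                                          , Equivalence.from (survives⇔¬InS P m odd-m 3P≤m) ¬s))
  (λ t → let (t-odd , t-survives) = Equivalence.to T-∧ t
             odd-m = %2≡1⇒odd (≡ᵇ⇒≡ (m % 2) 1 t-odd)
         in odd-m , Equivalence.to (survives⇔¬InS P m odd-m 3P≤m) t-survives)

isYes-Remnant? : ∀ P m → 3 * P ≤ m → isYes (Remnant? P m) ≡ sieve P m
isYes-Remnant? P m 3P≤m = trans (isYes≗does (Remnant? P m))
                                (does-⇔ (Remnant⇔sieve P m 3P≤m) (Remnant? P m) (T? (sieve P m)))

-- Remnants per period

L-nonZero : ∀ p → NonZero (L p)
L-nonZero zero = _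
L-nonZero (suc p) with isP5 (suc p)
... | true = m*n≢0 (suc p) (L p) {{_}} {{L-nonZero p}}
... | false = L-nonZero p

prime∣L⇒ : ∀ {q} p → Prime q → q ∣ L p → 5 ≤ q × q ≤ p
prime∣L⇒ zero pq q∣1 = contradiction (subst Prime (∣1⇒≡1 q∣1) pq) ¬prime[1]
prime∣L⇒ {q} (suc p) pq q∣L with isP5 (suc p) in eq
... | false = map₂ m≤n⇒m≤1+n (prime∣L⇒ p pq q∣L)
... | true with euclidsLemma (suc p) (L p) pq q∣L
...   | inj₂ q∣Lp = map₂ m≤n⇒m≤1+n (prime∣L⇒ p pq q∣Lp)
...   | inj₁ q∣1+p with prime⇒irreducible (proj₂ (isP5-sound eq)) q∣1+p
...     | inj₁ refl = contradiction pq ¬prime[1]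
...     | inj₂ refl = proj₁ (isP5-sound eq) , ≤-refl

survives-mod : ∀ p m d .{{_ : NonZero d}} → L p ∣ d → survives p (m % d) ≡ survives p m
survives-mod zero m d _ = refl
survives-mod (suc p) m d L∣d with isP5 (suc p)
... | false = survives-mod p m d L∣d
... | true = cong₂ _∧_ (cong (avoids (suc p)) (m∣n⇒o%n%m≡o%m (suc p) d m (m*n∣⇒m∣ (suc p) (L p) L∣d)))
                       (survives-mod p m d (m*n∣⇒n∣ (suc p) (L p) L∣d))

off≢q∸off : ∀ {q} → Prime q → 5 ≤ q → off q ≢ q ∸ off q
off≢q∸off {q} pq 5≤q o≡q∸o = contradiction (trans (sym q%2≡0) (prime≥5⇒odd pq 5≤q)) λ ()
  where
  q≡o+o : q ≡ off q + off q
  q≡o+o = trans (sym (m+[n∸m]≡n (<⇒≤ (off<q 5≤q)))) (cong (off q +_) (sym o≡q∸o))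
  q%2≡0 : q % 2 ≡ 0
  q%2≡0 = n∣m⇒m%n≡0 q 2 (subst (2 ∣_) (sym q≡o+o) (∣m∣n⇒∣m+n (2∣off q) (2∣off q)))

count-avoids : ∀ {q} → Prime q → 5 ≤ q → count (avoids q) q ≡ q ∸ 2
count-avoids {q} pq 5≤q = count-avoiding-two (off q) (q ∸ off q) q (off≢q∸off pq 5≤q) (off<q 5≤q)
                            (∸-monoʳ-< (off-positive 5≤q) (<⇒≤ (off<q 5≤q)))

count-survives : ∀ p → count (survives p) (L p) ≡ Pm2 p
count-survives zero = refl
count-survives (suc p) with isP5 (suc p) in eq
... | false = count-survives p
... | true = begin
  count (λ m → avoids q (m % q) ∧ survives p m) (q * L p)
    ≡⟨ sumBelow-cong (q * L p) (λ m _ → cong (λ b → indicator (avoids q (m % q) ∧ b))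
                                              (sym (survives-mod p m (L p) ∣-refl))) ⟩
  count (λ m → avoids q (m % q) ∧ survives p (m % L p)) (q * L p)
    ≡⟨ count-crt q (L p) pq (λ q∣L → <-irrefl refl (proj₂ (prime∣L⇒ p pq q∣L))) (avoids q) (survives p) ⟩
  count (avoids q) q * count (survives p) (L p)
    ≡⟨ cong₂ _*_ (count-avoids pq (proj₁ (isP5-sound eq))) (count-survives p) ⟩
  (q ∸ 2) * Pm2 p ∎
  where
  open ≡-Reasoning
  q : ℕ
  q = suc p
  pq : Prime q
  pq = proj₂ (isP5-sound eq)
  instance
    L≢0 : NonZero (L p)
    L≢0 = L-nonZero p

count-sieve : ∀ P → count (sieve P) (2 * L P) ≡ Pm2 P
count-sieve P = begin
  count (sieve P) (2 * L P)
    ≡⟨ sumBelow-cong (2 * L P) (λ m _ → cong (λ b → indicator ((m % 2 ≡ᵇ 1) ∧ b))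
                                              (sym (survives-mod P m (L P) ∣-refl))) ⟩
  count (λ m → (m % 2 ≡ᵇ 1) ∧ survives P (m % L P)) (2 * L P)
    ≡⟨ count-crt 2 (L P) prime[2] 2∤L (_≡ᵇ 1) (survives P) ⟩
  1 * count (survives P) (L P)
    ≡⟨ trans (*-identityˡ _) (count-survives P) ⟩
  Pm2 P ∎
  where
  open ≡-Reasoning
  instance
    L≢0 : NonZero (L P)
    L≢0 = L-nonZero P
  2∤L : ¬ 2 ∣ L P
  2∤L 2∣L = contradiction (proj₁ (prime∣L⇒ P prime[2] 2∣L)) λ { (s≤s (s≤s ())) }

sieve-periodic : ∀ P m → sieve P (2 * L P + m) ≡ sieve P m
sieve-periodic P m = cong₂ _∧_ (cong (_≡ᵇ 1) (%-remove-+ˡ m (divides (L P) (*-comm 2 (L P)))))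
  (begin
    survives P (2 * L P + m)             ≡⟨ survives-mod P (2 * L P + m) (2 * L P) L∣2L ⟨
    survives P ((2 * L P + m) % (2 * L P)) ≡⟨ cong (survives P) (%-remove-+ˡ m ∣-refl) ⟩
    survives P (m % (2 * L P))           ≡⟨ survives-mod P m (2 * L P) L∣2L ⟩
    survives P m                         ∎)
  where
  open ≡-Reasoning
  instance
    L≢0 : NonZero (L P)
    L≢0 = L-nonZero P
    2L≢0 : NonZero (2 * L P)
    2L≢0 = m*n≢0 2 (L P)
  L∣2L : L P ∣ 2 * L P
  L∣2L = n∣m*n 2

-- Density

-- Opened only here: earlier, +_ would clash with the ℕ sections (n +_).
open import Data.Integer using (+_)

∣⊖∣≡∣-∣ : ∀ m n → ℤ.∣ m ⊖ n ∣ ≡ ∣ m - n ∣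
∣⊖∣≡∣-∣ m n with ≤-total m n
... | inj₁ m≤n = trans (ℤ.∣⊖∣-≤ m≤n) (sym (m≤n⇒∣m-n∣≡n∸m m≤n))
... | inj₂ n≤m = trans (ℤ.∣m⊖n∣≡∣n⊖m∣ m n) (trans (ℤ.∣⊖∣-≤ n≤m) (sym (m≤n⇒∣n-m∣≡n∸m n≤m)))

-- |A/N − C/2| = |2A − CN| / 2N, and 2N · ε ≥ 2N / ↧ε > K.
∣A/N-½C∣<ε : ∀ A C K n (ε : ℚ) → ℚ.0ℚ ℚ.< ε → K * ↧ₙ ε < suc n → ∣ 2 * A - C * suc n ∣ ≤ K →
             ℚ.∣ (+ A) ℚ./ suc n ℚ.- ½ ℚ.* toQ C ∣ ℚ.< ε
∣A/N-½C∣<ε A C K n (mkℚ ℤ.+0 _ _) 0<ε _ _ = ⊥-elim (ℤ.Positive.pos (ℚ.positive 0<ε))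
∣A/N-½C∣<ε A C K n (mkℚ -[1+ _ ] _ _) 0<ε _ _ = ⊥-elim (ℤ.Positive.pos (ℚ.positive 0<ε))
∣A/N-½C∣<ε A C K n ε@(mkℚ +[1+ p ] d _) _ K*d<N ∣2A-CN∣≤K =
  ℚ.toℚᵘ-cancel-< (ℚᵘ.<-respˡ-≃ (ℚᵘ.≃-sym toℚᵘ∣x∣≃∣Y∣) (*<* numerators))
  where
  N : ℕ
  N = suc n
  x : ℚ
  x = (+ A) ℚ./ N ℚ.- ½ ℚ.* toQ C
  Y : ℚᵘ.ℚᵘ
  Y = mkℚᵘ (+ A) n ℚᵘ.+ ℚᵘ.- (mkℚᵘ (+ 1) 1 ℚᵘ.* mkℚᵘ (+ C) 0)

  toℚᵘ∣x∣≃∣Y∣ : toℚᵘ (ℚ.∣ x ∣) ℚᵘ.≃ ℚᵘ.∣ Y ∣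
  toℚᵘ∣x∣≃∣Y∣ = ℚᵘ.≃-trans (ℚ.toℚᵘ-homo-∣-∣ x) (ℚᵘ.∣-∣-cong (ℚᵘ.≃-trans
    (ℚ.toℚᵘ-homo-+ ((+ A) ℚ./ N) (ℚ.- (½ ℚ.* toQ C)))
    (ℚᵘ.+-cong (ℚ.toℚᵘ-fromℚᵘ (mkℚᵘ (+ A) n))
      (ℚᵘ.≃-trans (ℚ.toℚᵘ-homo‿- (½ ℚ.* toQ C)) (ℚᵘ.-‿cong (ℚᵘ.≃-trans (ℚ.toℚᵘ-homo-* ½ (toQ C))
        (ℚᵘ.*-cong ℚᵘ.≃-refl (ℚ.toℚᵘ-fromℚᵘ (mkℚᵘ (+ C) 0)))))))))

  ↥Y≡ : ℚᵘ.↥ Y ≡ (2 * A) ⊖ (C * N)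
  ↥Y≡ = begin
    + A ℤ.* + 2 ℤ.+ ℤ.- (+ 1 ℤ.* + C) ℤ.* + N
      ≡⟨ cong₂ ℤ._+_ (trans (sym (ℤ.pos-* A 2)) (cong +_ (*-comm A 2)))
                     (cong (λ c → ℤ.- c ℤ.* + N) (ℤ.*-identityˡ (+ C))) ⟩
    + (2 * A) ℤ.+ ℤ.- (+ C) ℤ.* + N
      ≡⟨ cong (λ z → + (2 * A) ℤ.+ z)
              (trans (sym (ℤ.neg-distribˡ-* (+ C) (+ N))) (cong ℤ.-_ (sym (ℤ.pos-* C N)))) ⟩
    + (2 * A) ℤ.+ ℤ.- + (C * N)
      ≡⟨ ℤ.m-n≡m⊖n (2 * A) (C * N) ⟩
    (2 * A) ⊖ (C * N) ∎
    where open ≡-Reasoning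

  ∣↥Y∣*d<[1+p]*[N*2] : ℤ.∣ ℚᵘ.↥ Y ∣ * suc d < suc p * (N * 2)
  ∣↥Y∣*d<[1+p]*[N*2] = begin-strict
    ℤ.∣ ℚᵘ.↥ Y ∣ * suc d ≡⟨ cong (λ z → ℤ.∣ z ∣ * suc d) ↥Y≡ ⟩
    ℤ.∣ (2 * A) ⊖ (C * N) ∣ * suc d ≡⟨ cong (_* suc d) (∣⊖∣≡∣-∣ (2 * A) (C * N)) ⟩
    ∣ 2 * A - C * N ∣ * suc d       ≤⟨ *-monoˡ-≤ (suc d) ∣2A-CN∣≤K ⟩
    K * suc d                       <⟨ K*d<N ⟩
    N                               ≤⟨ m≤m*n N 2 ⟩
    N * 2                           ≤⟨ m≤n*m (N * 2) (suc p) ⟩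
    suc p * (N * 2)                 ∎
    where open ≤-Reasoning

  numerators : + ℤ.∣ ℚᵘ.↥ Y ∣ ℤ.* + suc d ℤ.< +[1+ p ] ℤ.* + (N * 2)
  numerators = subst₂ ℤ._<_ (ℤ.pos-* ℤ.∣ ℚᵘ.↥ Y ∣ (suc d)) (ℤ.pos-* (suc p) (N * 2))
                            (ℤ.+<+ ∣↥Y∣*d<[1+p]*[N*2])

remnant-density : ∀ P (ε : ℚ) → ℚ.0ℚ ℚ.< ε → Σ ℕ (λ N₀ → (n : ℕ) → N₀ ≤ suc n →
  Σ ℕ (λ k → CountIs (Remnant P) (suc n) k
             × ℚ.∣ ((+ (L P * k)) ℚ./ suc n) ℚ.- (½ ℚ.* toQ (Pm2 P)) ∣ ℚ.< ε))
remnant-density P ε 0<ε = suc (K * ↧ₙ ε) , λ n K*↧ε<1+n →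
  remnants n , count-Remnant P (suc n) , ∣A/N-½C∣<ε (L P * remnants n) (Pm2 P) K n ε 0<ε K*↧ε<1+n (discrepancy n)
  where
  M B K : ℕ
  M = 2 * L P
  B = 3 * P
  K = M * (M + B)
  instance
    M≢0 : NonZero M
    M≢0 = m*n≢0 2 (L P) {{_}} {{L-nonZero P}}

  -- Index i stands for the integer i + 1, since CountIs counts 1, …, N.
  remnant₊ sieve₊ : ℕ → Bool
  remnant₊ i = isYes (Remnant? P (suc i))
  sieve₊ i = sieve P (suc i)

  remnants : ℕ → ℕ
  remnants n = count remnant₊ (suc n)

  sieve₊-periodic : ∀ i → sieve₊ (M + i) ≡ sieve₊ i
  sieve₊-periodic i = trans (cong (sieve P) (sym (+-suc M i))) (sieve-periodic P (suc i))

  agree : ∀ i → B ≤ i → remnant₊ i ≡ sieve₊ i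
  agree i B≤i = isYes-Remnant? P (suc i) (m≤n⇒m≤1+n B≤i)

  count-sieve₊ : count sieve₊ M ≡ Pm2 P
  count-sieve₊ = trans (count-rotate (sieve P) M (sieve-periodic P)) (count-sieve P)

  discrepancy : ∀ n → ∣ 2 * (L P * remnants n) - Pm2 P * suc n ∣ ≤ K
  discrepancy n = subst₂ (λ a c → ∣ a - c * suc n ∣ ≤ K) (*-assoc 2 (L P) (remnants n)) count-sieve₊
                    (∣M*count-C*N∣≤M*[M+B] remnant₊ sieve₊ M B sieve₊-periodic agree (suc n))

-- The products

toQ-* : ∀ a b → toQ (a * b) ≡ toQ a ℚ.* toQ b
toQ-* a b = ℚ.toℚᵘ-injective (ℚᵘ.≃-trans (ℚ.toℚᵘ-fromℚᵘ (mkℚᵘ (+ (a * b)) 0))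
  (ℚᵘ.≃-sym (ℚᵘ.≃-trans (ℚ.toℚᵘ-homo-* (toQ a) (toQ b))
    (ℚᵘ.≃-trans (ℚᵘ.*-cong (ℚ.toℚᵘ-fromℚᵘ (mkℚᵘ (+ a) 0)) (ℚ.toℚᵘ-fromℚᵘ (mkℚᵘ (+ b) 0)))
                (ℚᵘ.*≡* (cong (ℤ._* + 1) (sym (ℤ.pos-* a b))))))))

c/n*n≡c : ∀ c n → ((+ c) ℚ./ suc n) ℚ.* toQ (suc n) ≡ toQ c
c/n*n≡c c n = ℚ.toℚᵘ-injective (ℚᵘ.≃-trans (ℚ.toℚᵘ-homo-* ((+ c) ℚ./ suc n) (toQ (suc n)))
  (ℚᵘ.≃-trans (ℚᵘ.*-cong (ℚ.toℚᵘ-fromℚᵘ (mkℚᵘ (+ c) n)) (ℚ.toℚᵘ-fromℚᵘ (mkℚᵘ (+ suc n) 0)))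
    (ℚᵘ.≃-trans (ℚᵘ.*≡* cross) (ℚᵘ.≃-sym (ℚ.toℚᵘ-fromℚᵘ (mkℚᵘ (+ c) 0))))))
  where
  cross : (+ c ℤ.* + suc n) ℤ.* + 1 ≡ + c ℤ.* + (suc n * 1)
  cross = trans (ℤ.*-identityʳ _) (cong (λ k → + c ℤ.* + k) (sym (*-identityʳ (suc n))))

ratioProd*L≡Pm2 : ∀ n → ratioProd n ℚ.* toQ (L n) ≡ toQ (Pm2 n)
ratioProd*L≡Pm2 zero = ℚ.*-identityˡ _
ratioProd*L≡Pm2 (suc n) with isP5 (suc n)
... | false = ratioProd*L≡Pm2 n
... | true = begin
  (f ℚ.* ratioProd n) ℚ.* toQ (suc n * L n)           ≡⟨ cong ((f ℚ.* ratioProd n) ℚ.*_) (toQ-* (suc n) (L n)) ⟩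
  (f ℚ.* ratioProd n) ℚ.* (toQ (suc n) ℚ.* toQ (L n)) ≡⟨ interchange f (ratioProd n) (toQ (suc n)) (toQ (L n)) ⟩
  (f ℚ.* toQ (suc n)) ℚ.* (ratioProd n ℚ.* toQ (L n)) ≡⟨ cong₂ ℚ._*_ (c/n*n≡c (suc n ∸ 2) n) (ratioProd*L≡Pm2 n) ⟩
  toQ (suc n ∸ 2) ℚ.* toQ (Pm2 n)                     ≡⟨ toQ-* (suc n ∸ 2) (Pm2 n) ⟨
  toQ ((suc n ∸ 2) * Pm2 n)                           ∎
  where
  open ≡-Reasoning
  open +-*-Solver
  f : ℚ
  f = (+ (suc n ∸ 2)) ℚ./ suc n
  interchange : ∀ a b c d → (a ℚ.* b) ℚ.* (c ℚ.* d) ≡ (a ℚ.* c) ℚ.* (b ℚ.* d)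
  interchange = solve 4 (λ a b c d → (a :* b) :* (c :* d) := (a :* c) :* (b :* d)) refl

½L-S≡½Pm2 : ∀ P → (½ ℚ.* toQ (L P)) ℚ.- Sfun P ≡ ½ ℚ.* toQ (Pm2 P)
½L-S≡½Pm2 P = trans (factor ½ (toQ (L P)) (ratioProd P)) (cong (½ ℚ.*_) (ratioProd*L≡Pm2 P))
  where
  open +-*-Solver
  factor : ∀ h l r → (h ℚ.* l) ℚ.- (h ℚ.* l) ℚ.* (ℚ.1ℚ ℚ.- r) ≡ h ℚ.* (r ℚ.* l)
  factor = solve 3 (λ h l r → (h :* l) :- (h :* l) :* (con ℚ.1ℚ :- r) := h :* (r :* l)) refl

xfrac*L≡½Pm2 : ∀ P → xfrac P ℚ.* toQ (L P) ≡ ½ ℚ.* toQ (Pm2 P)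
xfrac*L≡½Pm2 P = trans (ℚ.*-assoc ½ (ratioProd P) (toQ (L P))) (cong (½ ℚ.*_) (ratioProd*L≡Pm2 P))

Pm2-prime-free : ∀ {P} Q → P ≤ Q → (∀ r → P < r → r ≤ Q → ¬ Prime r) → Pm2 Q ≡ Pm2 P
Pm2-prime-free zero z≤n _ = refl
Pm2-prime-free {P} (suc Q) P≤1+Q gap with P ≟ suc Q
... | yes refl = refl
... | no P≢1+Q with isP5 (suc Q) in eq
...   | true = contradiction (proj₂ (isP5-sound eq)) (gap (suc Q) (≤∧≢⇒< P≤1+Q P≢1+Q) ≤-refl)
...   | false = Pm2-prime-free Q (≤-pred (≤∧≢⇒< P≤1+Q P≢1+Q)) (λ r P<r r≤Q → gap r P<r (m≤n⇒m≤1+n r≤Q))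

G≡Pm2 : ∀ {P Q} → P < Q → (∀ r → P < r → r < Q → ¬ Prime r) → G Q ≡ Pm2 P
G≡Pm2 {Q = suc Q} (s≤s P≤Q) gap = Pm2-prime-free Q P≤Q (λ r P<r r≤Q → gap r P<r (s≤s r≤Q))

a/b<c/d : ∀ a b c d → a * suc d < c * suc b → (+ a) ℚ./ suc b ℚ.< (+ c) ℚ./ suc d
a/b<c/d a b c d ad<cb = ℚ.toℚᵘ-cancel-<
  (ℚᵘ.<-respˡ-≃ (ℚᵘ.≃-sym (ℚ.toℚᵘ-fromℚᵘ (mkℚᵘ (+ a) b)))
    (ℚᵘ.<-respʳ-≃ (ℚᵘ.≃-sym (ℚ.toℚᵘ-fromℚᵘ (mkℚᵘ (+ c) d)))
      (*<* (subst₂ ℤ._<_ (ℤ.pos-* a (suc d)) (ℤ.pos-* c (suc b)) (ℤ.+<+ ad<cb)))))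

module _ {n} (5≤q : 5 ≤ suc n) where

  private
    f : ℚ
    f = (+ (suc n ∸ 2)) ℚ./ suc n

  0<[q-2]/q : ℚ.0ℚ ℚ.< f
  0<[q-2]/q = a/b<c/d 0 0 (suc n ∸ 2) n (≤-trans (s≤s z≤n) (*-monoˡ-≤ 1 (∸-monoˡ-≤ 2 5≤q)))

  [q-2]/q<1 : f ℚ.< ℚ.1ℚ
  [q-2]/q<1 = a/b<c/d (suc n ∸ 2) n 1 0 (s≤s (begin
    (n ∸ 1) * 1 ≡⟨ *-identityʳ (n ∸ 1) ⟩
    n ∸ 1       ≤⟨ m∸n≤m n 1 ⟩
    n           ≡⟨ +-identityʳ n ⟨
    n + 0       ∎))
    where open ≤-Reasoning

ratioProd-positive : ∀ n → ℚ.0ℚ ℚ.< ratioProd n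
ratioProd-positive zero = a/b<c/d 0 0 1 0 (s≤s z≤n)
ratioProd-positive (suc n) with isP5 (suc n) in eq
... | false = ratioProd-positive n
... | true = subst (ℚ._< f ℚ.* ratioProd n) (ℚ.*-zeroˡ (ratioProd n))
                   (ℚ.*-monoˡ-<-pos (ratioProd n) {{ℚ.positive (ratioProd-positive n)}}
                                    (0<[q-2]/q {n} (proj₁ (isP5-sound {suc n} eq))))
  where
  f : ℚ
  f = (+ (suc n ∸ 2)) ℚ./ suc n

factor*ratioProd< : ∀ n → 5 ≤ suc n → (+ (suc n ∸ 2)) ℚ./ suc n ℚ.* ratioProd n ℚ.< ratioProd n
factor*ratioProd< n 5≤q = subst ((+ (suc n ∸ 2)) ℚ./ suc n ℚ.* ratioProd n ℚ.<_) (ℚ.*-identityˡ (ratioProd n))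
  (ℚ.*-monoˡ-<-pos (ratioProd n) {{ℚ.positive (ratioProd-positive n)}} ([q-2]/q<1 5≤q))

ratioProd-suc-≤ : ∀ n → ratioProd (suc n) ℚ.≤ ratioProd n
ratioProd-suc-≤ n with isP5 (suc n) in eq
... | false = ℚ.≤-refl
... | true = ℚ.<⇒≤ (factor*ratioProd< n (proj₁ (isP5-sound {suc n} eq)))

ratioProd-step : ∀ n → 5 ≤ suc n → Prime (suc n) → ratioProd (suc n) ℚ.< ratioProd n
ratioProd-step n 5≤q pq rewrite isP5-complete 5≤q pq = factor*ratioProd< n 5≤q

ratioProd-antitone : ∀ {m n} → m ≤ n → ratioProd n ℚ.≤ ratioProd m
ratioProd-antitone = antitone′ ∘ ≤⇒≤′
  where
  antitone′ : ∀ {m n} → m ≤′ n → ratioProd n ℚ.≤ ratioProd m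
  antitone′ ≤′-refl = ℚ.≤-refl
  antitone′ {n = suc n} (≤′-step m≤′n) = ℚ.≤-trans (ratioProd-suc-≤ n) (antitone′ m≤′n)

xfrac-decreasing : ∀ {P Q} → Prime Q → 5 ≤ Q → P < Q → xfrac Q ℚ.< xfrac P
xfrac-decreasing {P} {suc Q} pQ 5≤Q (s≤s P≤Q) =
  ℚ.*-monoʳ-<-pos ½ (ℚ.<-≤-trans (ratioProd-step Q 5≤Q pQ) (ratioProd-antitone P≤Q))

lemma4p7 : ((P : ℕ) → Prime P → 5 ≤ P →
    -- density of remnants times L(P) equals ½ ∏ (p − 2)
    ((ε : ℚ) → ℚ.0ℚ ℚ.< ε → Σ ℕ (λ N₀ → (n : ℕ) → N₀ ≤ suc n →
    Σ ℕ (λ k → CountIs (Remnant P) (suc n) k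
    × ℚ.∣ ((+ (L P * k)) ℚ./ suc n) ℚ.- (½ ℚ.* toQ (Pm2 P)) ∣ ℚ.< ε)))
    × ((½ ℚ.* toQ (L P)) ℚ.- Sfun P ≡ ½ ℚ.* toQ (Pm2 P))
    × ((Q : ℕ) → Prime Q → P < Q → ((r : ℕ) → P < r → r < Q → ¬ Prime r) →
    ½ ℚ.* toQ (Pm2 P) ≡ ½ ℚ.* toQ (G Q))
    × (xfrac P ℚ.* toQ (L P) ≡ ½ ℚ.* toQ (Pm2 P)))
    × ((P Q : ℕ) → Prime P → Prime Q → 5 ≤ P → P < Q → xfrac Q ℚ.< xfrac P)
lemma4p7 =
  (λ P _ _ → remnant-density P
           , ½L-S≡½Pm2 P
           , (λ Q _ P<Q gap → cong (λ x → ½ ℚ.* toQ x) (sym (G≡Pm2 P<Q gap)))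
           , xfrac*L≡½Pm2 P)
  , λ P Q _ pQ 5≤P P<Q → xfrac-decreasing pQ (≤-trans 5≤P (<⇒≤ P<Q)) P<Q
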